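{- Let $\mathcal{S}$ be a set of LU-theories in a common relational language $\Sigma$ that are pairwise language similar. Then the relation $\sqsubseteq^L$ is a partial order on $\mathcal{S}$.
   Context: A complete theory $T$ in a relational language $\Sigma$ is language uniform (an LU-theory) if for each arity $n$, every permutation of the set of $n$-ary symbols $R\in\Sigma$ with $T\vdash\exists\bar x R(\bar x)$ (the non-empty $n$-ary predicates for $T$), extended by the identity on all other symbols, transforms $T$ into $T$ itself. Theories $T_1,T_2$ of the same language $\Sigma$ are language similar if $T_1$ is obtained from $T_2$ by some (arity-preserving) bijective replacement of the symbols of $\Sigma$. For language similar $T_1,T_2$ of the same language $\Sigma$, $T_1\sqsubseteq^L T_2$ means: for every symbol $R\in\Sigma$, if $T_1\vdash\exists\bar x R(\bar x)$ then $T_2\vdash\exists\bar x R(\bar x)$. -}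

module Defs where

open import Level using (Level; _⊔_) renaming (suc to lsuc; zero to lzero)
open import Data.Nat using (ℕ; zero; suc)
open import Data.Fin using (Fin; zero; suc)
open import Data.Vec using (Vec; map; allFin)
open import Data.Product using (Σ; Σ-syntax; _×_; _,_; proj₁)
open import Data.Sum using (_⊎_)
open import Data.Empty using (⊥)
open import Relation.Nullary using (¬_)
open import Relation.Binary.PropositionalEquality using (_≡_; _≢_; subst; sym)
open import Function.Bundles using (_↔_; Inverse)

record Language : Set₁ where
  field
    Sym   : Set
    arity : Sym → ℕ

module _ (L : Language) where
  open Language L

  -- First-order formulas (with equality) over L, de Bruijn variables;
  -- Formula n = formulas with free variables among n.
  -- Relational language: the only terms are variables.
  data Formula (n : ℕ) : Set where
    rel  : (R : Sym) → Vec (Fin n) (arity R) → Formula n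
    _≐_  : Fin n → Fin n → Formula n
    ⊥'   : Formula n
    _⇒_  : Formula n → Formula n → Formula n
    ∀'   : Formula (suc n) → Formula n

  Sentence : Set
  Sentence = Formula 0

  ¬' : ∀ {n} → Formula n → Formula n
  ¬' φ = φ ⇒ ⊥'

  ∃' : ∀ {n} → Formula (suc n) → Formula n
  ∃' φ = ¬' (∀' (¬' φ))

  closeEx : ∀ {k} → Formula k → Sentence
  closeEx {zero}  φ = φ
  closeEx {suc k} φ = closeEx {k} (∃' φ)

  nonEmptySent : Sym → Sentence
  nonEmptySent R = closeEx (rel R (allFin (arity R)))

  -- L-structures (non-empty domain, as usual in first-order logic)
  record Structure : Set₁ where
    field
      Carrier    : Set
      inhabitant : Carrier
      Rel        : (R : Sym) → Vec Carrier (arity R) → Set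

  extend : ∀ {A : Set} {n} → A → (Fin n → A) → Fin (suc n) → A
  extend a ρ zero    = a
  extend a ρ (suc i) = ρ i

  ⟦_⟧ : ∀ {n} → Formula n → (M : Structure) → (Fin n → Structure.Carrier M) → Set
  ⟦ rel R xs ⟧ M ρ = Structure.Rel M R (map ρ xs)
  ⟦ x ≐ y ⟧    M ρ = ρ x ≡ ρ y
  ⟦ ⊥' ⟧       M ρ = ⊥
  ⟦ φ ⇒ ψ ⟧    M ρ = ⟦ φ ⟧ M ρ → ⟦ ψ ⟧ M ρ
  ⟦ ∀' φ ⟧     M ρ = (a : Structure.Carrier M) → ⟦ φ ⟧ M (extend a ρ)

  _⊨_ : Structure → Sentence → Set
  M ⊨ φ = ⟦ φ ⟧ M (λ ())

  Theory : Set₁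
  Theory = Sentence → Set

  _⊨T_ : Structure → Theory → Set
  M ⊨T T = ∀ φ → T φ → M ⊨ φ

  -- T ⊢ φ : consequence (semantic; equivalent to provability by Gödel completeness)
  _⊢_ : Theory → Sentence → Set₁
  T ⊢ φ = (M : Structure) → M ⊨T T → M ⊨ φ

  record CompleteTheory (T : Theory) : Set₁ where
    field
      closed     : ∀ φ → T ⊢ φ → T φ
      consistent : ¬ (T ⊢ ⊥')
      complete   : ∀ φ → T φ ⊎ T (¬' φ)

  _≈T_ : Theory → Theory → Set
  T ≈T T' = ∀ φ → (T φ → T' φ) × (T' φ → T φ)

  record SymBij : Set where
    field
      bij        : Sym ↔ Sym
      arity-pres : ∀ R → arity (Inverse.to bij R) ≡ arity R
    app : Sym → Sym
    app = Inverse.to bij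

  renSym : SymBij → ∀ {n} → Formula n → Formula n
  renSym σ {n} (rel R xs) =
    rel (SymBij.app σ R) (subst (Vec (Fin n)) (sym (SymBij.arity-pres σ R)) xs)
  renSym σ (x ≐ y)  = x ≐ y
  renSym σ ⊥'       = ⊥'
  renSym σ (φ ⇒ ψ)  = renSym σ φ ⇒ renSym σ ψ
  renSym σ (∀' φ)   = ∀' (renSym σ φ)

  image : SymBij → Theory → Theory
  image σ T φ = Σ[ ψ ∈ Sentence ] (T ψ × renSym σ ψ ≡ φ)

  NonEmpty : Theory → Sym → Set₁
  NonEmpty T R = T ⊢ nonEmptySent R

  record LU (T : Theory) : Set₁ where
    field
      isComplete : CompleteTheory T
      uniform    : ∀ (n : ℕ) (π : SymBij) →
                   (∀ R → (arity R ≢ n ⊎ ¬ NonEmpty T R) → SymBij.app π R ≡ R) →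
                   image π T ≈T T

  LanguageSimilar : Theory → Theory → Set
  LanguageSimilar T₁ T₂ = Σ[ σ ∈ SymBij ] (T₁ ≈T image σ T₂)

  _⊑L_ : Theory → Theory → Set₁
  T₁ ⊑L T₂ = ∀ R → NonEmpty T₁ R → NonEmpty T₂ R

module Submission where

-- Reflexivity and transitivity of ⊑L (and the equivalence properties of ≈T)
-- are immediate; the content is antisymmetry.  Let T₁ ≈ σ(T₂) with
-- T₁ ⊑L T₂ ⊑L T₁.  Then σ maps the non-empty predicates of T₂ exactly onto
-- themselves, and the heart of the proof is the following invariance
-- principle: an LU-theory T is closed under every arity-preserving symbol
-- bijection σ that preserves and reflects the non-empty predicates of T.
-- The LU property only provides invariance under permutations of a SINGLE
-- arity, so we approximate σ by the bijections below K, which act as σ on the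
-- non-empty predicates of arity < K and as the identity elsewhere: below (K+1)
-- is below K followed by a permutation of arity K, so T is closed under each
-- of them.  In a model of T the empty predicates are interpreted by empty
-- relations, so σ and below K agree semantically on all symbols of arity < K;
-- hence σψ is a consequence of T for each ψ ∈ T, and σψ ∈ T since T is
-- deductively closed.  This gives σ(T₂) ⊆ T₂, i.e. T₁ ⊆ T₂, and complete
-- theories are maximal consistent, so T₁ ≈ T₂.

open import Defs
open import Level using (Level)
open import Data.Nat using (ℕ; zero; suc; _<_; _≤_; _⊔_; _≟_; _<?_)
open import Data.Nat.Properties
  using (≡-irrelevant; <-cmp; <-irrefl; <-asym; n≮0; <⇒≢; >⇒≢; m<n⇒m<1+n; n<1+n; <⇒≱; ≤-pred; ≤-trans; ≤-refl; m≤m⊔n; m≤n⊔m)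
open import Data.Fin using (Fin; zero; suc)
open import Data.Vec using (Vec; map; allFin; lookup)
open import Data.Vec.Properties using (map-cong; map-lookup-allFin)
open import Data.Product using (Σ; _×_; _,_; proj₁; proj₂)
open import Data.Sum using (_⊎_; inj₁; inj₂; [_,_])
open import Data.Empty using (⊥-elim)
open import Relation.Nullary using (¬_; Dec; yes; no; contradiction)
open import Relation.Nullary.Decidable using (_×-dec_)
open import Relation.Binary.Definitions using (Tri; tri<; tri≈; tri>)
open import Relation.Binary.Structures using (IsPartialOrder)
open import Relation.Binary.PropositionalEquality
  using (_≡_; _≢_; refl; sym; trans; cong; cong₂; subst; module ≡-Reasoning)
open import Relation.Binary.PropositionalEquality.Properties using (subst-subst)
open import Function using (_∘_)
open import Function.Bundles using (_⇔_; mk⇔; Equivalence; Inverse; mk↔ₛ′)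

open Equivalence using (to; from)
open ≡-Reasoning

module _ (L : Language) where
  open Language L
  open SymBij using (app; arity-pres)
  open Structure using (Rel)

  module Restrict {ℓ} (σ : SymBij L) (P : Sym → Set ℓ) (P? : ∀ R → Dec (P R))
                  (P-inv : ∀ R → P (app σ R) ⇔ P R) where
    private
      σ⁻¹ : Sym → Sym
      σ⁻¹ = Inverse.from (SymBij.bij σ)

      σσ⁻¹ : ∀ R → app σ (σ⁻¹ R) ≡ R
      σσ⁻¹ = Inverse.strictlyInverseˡ (SymBij.bij σ)

      σ⁻¹σ : ∀ R → σ⁻¹ (app σ R) ≡ R
      σ⁻¹σ = Inverse.strictlyInverseʳ (SymBij.bij σ)

      P-inv⁻¹ : ∀ R → P R → P (σ⁻¹ R)
      P-inv⁻¹ R p = to (P-inv (σ⁻¹ R)) (subst P (sym (σσ⁻¹ R)) p)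

    fwd : Sym → Sym
    fwd R with P? R
    ... | yes _ = app σ R
    ... | no  _ = R

    bwd : Sym → Sym
    bwd R with P? R
    ... | yes _ = σ⁻¹ R
    ... | no  _ = R

    fwd-on : ∀ R → P R → fwd R ≡ app σ R
    fwd-on R p with P? R
    ... | yes _  = refl
    ... | no ¬p = contradiction p ¬p

    fwd-off : ∀ R → ¬ P R → fwd R ≡ R
    fwd-off R ¬p with P? R
    ... | yes p = contradiction p ¬p
    ... | no  _ = refl

    bwd-on : ∀ R → P R → bwd R ≡ σ⁻¹ R
    bwd-on R p with P? R
    ... | yes _  = refl
    ... | no ¬p = contradiction p ¬p

    bwd-off : ∀ R → ¬ P R → bwd R ≡ R
    bwd-off R ¬p with P? R
    ... | yes p = contradiction p ¬p
    ... | no  _ = refl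

    byCases : ∀ {b} {B : Set b} R → (P R → B) → (¬ P R → B) → B
    byCases R on off with P? R
    ... | yes p  = on p
    ... | no ¬p = off ¬p

    fwd-bwd : ∀ R → fwd (bwd R) ≡ R
    fwd-bwd R = byCases R
      (λ p → trans (cong fwd (bwd-on R p)) (trans (fwd-on (σ⁻¹ R) (P-inv⁻¹ R p)) (σσ⁻¹ R)))
      (λ ¬p → trans (cong fwd (bwd-off R ¬p)) (fwd-off R ¬p))

    bwd-fwd : ∀ R → bwd (fwd R) ≡ R
    bwd-fwd R = byCases R
      (λ p → trans (cong bwd (fwd-on R p)) (trans (bwd-on (app σ R) (from (P-inv R) p)) (σ⁻¹σ R)))
      (λ ¬p → trans (cong bwd (fwd-off R ¬p)) (bwd-off R ¬p))

    fwd-arity : ∀ R → arity (fwd R) ≡ arity R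
    fwd-arity R with P? R
    ... | yes _ = arity-pres σ R
    ... | no  _ = refl

    restrict : SymBij L
    restrict = record { bij = mk↔ₛ′ fwd bwd fwd-bwd bwd-fwd ; arity-pres = fwd-arity }

  rel-cast-cong : ∀ {n k} {a b : Sym} (xs : Vec (Fin n) k) (p : k ≡ arity a) (q : k ≡ arity b) →
                  a ≡ b → rel {L} a (subst (Vec (Fin n)) p xs) ≡ rel b (subst (Vec (Fin n)) q xs)
  rel-cast-cong xs p q refl = cong (λ r → rel _ (subst (Vec (Fin _)) r xs)) (≡-irrelevant p q)

  renSym-compose : (σ τ υ : SymBij L) → (∀ R → app σ (app τ R) ≡ app υ R) →
                   ∀ {n} (ψ : Formula L n) → renSym L σ (renSym L τ ψ) ≡ renSym L υ ψ
  renSym-compose σ τ υ στ≡υ {n} (rel R xs) =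
    trans (cong (rel _) (subst-subst {P = Vec (Fin n)} (sym (arity-pres τ R))
                           {y≡z = sym (arity-pres σ (app τ R))} {p = xs}))
          (rel-cast-cong xs _ _ (στ≡υ R))
  renSym-compose σ τ υ στ≡υ (x ≐ y) = refl
  renSym-compose σ τ υ στ≡υ ⊥'      = refl
  renSym-compose σ τ υ στ≡υ (φ ⇒ ψ) = cong₂ _⇒_ (renSym-compose σ τ υ στ≡υ φ) (renSym-compose σ τ υ στ≡υ ψ)
  renSym-compose σ τ υ στ≡υ (∀' φ)  = cong ∀' (renSym-compose σ τ υ στ≡υ φ)

  renSym-id : (υ : SymBij L) → (∀ R → app υ R ≡ R) → ∀ {n} (ψ : Formula L n) → renSym L υ ψ ≡ ψ
  renSym-id υ υ≡id (rel R xs) = rel-cast-cong xs _ refl (υ≡id R)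
  renSym-id υ υ≡id (x ≐ y)    = refl
  renSym-id υ υ≡id ⊥'         = refl
  renSym-id υ υ≡id (φ ⇒ ψ)    = cong₂ _⇒_ (renSym-id υ υ≡id φ) (renSym-id υ υ≡id ψ)
  renSym-id υ υ≡id (∀' φ)     = cong ∀' (renSym-id υ υ≡id φ)

  renSym-closeEx : (σ : SymBij L) → ∀ {k} (φ : Formula L k) →
                   renSym L σ (closeEx L φ) ≡ closeEx L (renSym L σ φ)
  renSym-closeEx σ {zero}  φ = refl
  renSym-closeEx σ {suc k} φ = renSym-closeEx σ {k} (∃' L φ)

  closeEx-cast : (S : Sym) (k : ℕ) (e : k ≡ arity S) →
                 closeEx L {k} (rel S (subst (Vec (Fin k)) e (allFin k))) ≡ nonEmptySent L S
  closeEx-cast S .(arity S) refl = refl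

  renSym-nonEmptySent : (σ : SymBij L) (R : Sym) →
                        renSym L σ (nonEmptySent L R) ≡ nonEmptySent L (app σ R)
  renSym-nonEmptySent σ R =
    trans (renSym-closeEx σ (rel R (allFin (arity R))))
          (closeEx-cast (app σ R) (arity R) (sym (arity-pres σ R)))

  symBound : ∀ {n} → Formula L n → ℕ
  symBound (rel R xs) = suc (arity R)
  symBound (x ≐ y)    = 0
  symBound ⊥'         = 0
  symBound (φ ⇒ ψ)    = symBound φ ⊔ symBound ψ
  symBound (∀' φ)     = symBound φ

  reductRel : SymBij L → (M : Structure L) (R : Sym) → Vec (Structure.Carrier M) (arity R) → Set
  reductRel σ M R ys = Rel M (app σ R) (subst (Vec _) (sym (arity-pres σ R)) ys)

  reductRel-cong : (σ τ : SymBij L) (M : Structure L) (R : Sym) → app σ R ≡ app τ R →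
                   ∀ ys → reductRel σ M R ys → reductRel τ M R ys
  reductRel-cong σ τ M R σR≡τR ys = transport σR≡τR (sym (arity-pres σ R)) (sym (arity-pres τ R))
    where
    transport : ∀ {a b} → a ≡ b → (p : arity R ≡ arity a) (q : arity R ≡ arity b) →
                Rel M a (subst (Vec _) p ys) → Rel M b (subst (Vec _) q ys)
    transport refl p q = subst (λ r → Rel M _ (subst (Vec _) r ys)) (≡-irrelevant p q)

  map-subst : ∀ {A B : Set} (f : A → B) {k m} (p : k ≡ m) (xs : Vec A k) →
              map f (subst (Vec A) p xs) ≡ subst (Vec B) p (map f xs)
  map-subst f refl xs = refl

  renSym-agree : (σ τ : SymBij L) (M : Structure L) (K : ℕ) →
    (∀ R → arity R < K → ∀ ys → reductRel σ M R ys ⇔ reductRel τ M R ys) →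
    ∀ {n} (ψ : Formula L n) → symBound ψ ≤ K → ∀ ρ →
    ⟦_⟧ L (renSym L σ ψ) M ρ ⇔ ⟦_⟧ L (renSym L τ ψ) M ρ
  renSym-agree σ τ M K agree (rel R xs) R<K ρ
    rewrite map-subst ρ (sym (arity-pres σ R)) xs | map-subst ρ (sym (arity-pres τ R)) xs
    = agree R R<K (map ρ xs)
  renSym-agree σ τ M K agree (x ≐ y) _ ρ = mk⇔ (λ h → h) (λ h → h)
  renSym-agree σ τ M K agree ⊥'      _ ρ = mk⇔ (λ h → h) (λ h → h)
  renSym-agree σ τ M K agree (φ ⇒ ψ) b ρ =
    mk⇔ (λ h a → to ψ↔ (h (from φ↔ a))) (λ h a → from ψ↔ (h (to φ↔ a)))
    where
    φ↔ = renSym-agree σ τ M K agree φ (≤-trans (m≤m⊔n (symBound φ) (symBound ψ)) b) ρ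
    ψ↔ = renSym-agree σ τ M K agree ψ (≤-trans (m≤n⊔m (symBound φ) (symBound ψ)) b) ρ
  renSym-agree σ τ M K agree (∀' φ) b ρ =
    mk⇔ (λ h a → to (φ↔ a) (h a)) (λ h a → from (φ↔ a) (h a))
    where
    φ↔ = λ a → renSym-agree σ τ M K agree φ b (extend L a ρ)

  ⟦⟧-env-cong : ∀ {n} (φ : Formula L n) (M : Structure L) (ρ ρ' : Fin n → Structure.Carrier M) →
                (∀ i → ρ i ≡ ρ' i) → ⟦_⟧ L φ M ρ → ⟦_⟧ L φ M ρ'
  ⟦⟧-env-cong (rel R xs) M ρ ρ' e h = subst (Rel M R) (map-cong e xs) h
  ⟦⟧-env-cong (x ≐ y)    M ρ ρ' e h = trans (sym (e x)) (trans h (e y))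
  ⟦⟧-env-cong ⊥'         M ρ ρ' e h = h
  ⟦⟧-env-cong (φ ⇒ ψ)    M ρ ρ' e h =
    λ a → ⟦⟧-env-cong ψ M ρ ρ' e (h (⟦⟧-env-cong φ M ρ' ρ (λ i → sym (e i)) a))
  ⟦⟧-env-cong (∀' φ)     M ρ ρ' e h =
    λ a → ⟦⟧-env-cong φ M (extend L a ρ) (extend L a ρ') (λ { zero → refl ; (suc i) → e i }) (h a)

  ⊨-closeEx : ∀ {k} (φ : Formula L k) (M : Structure L) (ρ : Fin k → Structure.Carrier M) →
              ⟦_⟧ L φ M ρ → _⊨_ L M (closeEx L φ)
  ⊨-closeEx {zero}  φ M ρ h = ⟦⟧-env-cong φ M ρ (λ ()) (λ ()) h
  ⊨-closeEx {suc k} φ M ρ h = ⊨-closeEx {k} (∃' L φ) M (λ i → ρ (suc i))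
    (λ ¬φ → ¬φ (ρ zero) (⟦⟧-env-cong φ M ρ _ (λ { zero → refl ; (suc i) → refl }) h))

  ⊨-nonEmptySent : (M : Structure L) (R : Sym) (ys : Vec (Structure.Carrier M) (arity R)) →
                   Rel M R ys → _⊨_ L M (nonEmptySent L R)
  ⊨-nonEmptySent M R ys h = ⊨-closeEx (rel R (allFin (arity R))) M (lookup ys)
    (subst (Rel M R) (sym (map-lookup-allFin ys)) h)

  member⇒⊢ : (T : Theory L) {φ : Sentence L} → T φ → _⊢_ L T φ
  member⇒⊢ T t M M⊨T = M⊨T _ t

  member-contradiction : (T : Theory L) {φ : Sentence L} → T φ → T (¬' L φ) → _⊢_ L T (⊥' {L})
  member-contradiction T t ¬t M M⊨T = member⇒⊢ T ¬t M M⊨T (member⇒⊢ T t M M⊨T)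

  module Complete {T : Theory L} (C : CompleteTheory L T) where
    open CompleteTheory C

    nonEmpty? : ∀ R → Dec (NonEmpty L T R)
    nonEmpty? R with complete (nonEmptySent L R)
    ... | inj₁ t  = yes (member⇒⊢ T t)
    ... | inj₂ ¬t = no (λ ne → consistent (λ M M⊨T → member⇒⊢ T ¬t M M⊨T (ne M M⊨T)))

    empty-in-model : (M : Structure L) → _⊨T_ L M T → ∀ R → ¬ NonEmpty L T R → ∀ ys → ¬ Rel M R ys
    empty-in-model M M⊨T R ¬ne ys h with complete (nonEmptySent L R)
    ... | inj₁ t  = ¬ne (member⇒⊢ T t)
    ... | inj₂ ¬t = M⊨T _ ¬t (⊨-nonEmptySent M R ys h)

    maximal : (T' : Theory L) → ¬ (_⊢_ L T' (⊥' {L})) → (∀ φ → T φ → T' φ) → ∀ φ → T' φ → T φ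
    maximal T' consistent' T⊆T' φ t' with complete φ
    ... | inj₁ t  = t
    ... | inj₂ ¬t = ⊥-elim (consistent' (member-contradiction T' t' (T⊆T' _ ¬t)))

    image-reflects : (σ : SymBij L) (T' : Theory L) → _≈T_ L T' (image L σ T) →
                     ¬ (_⊢_ L T' (⊥' {L})) → ∀ φ → T' (renSym L σ φ) → T φ
    image-reflects σ T' T'≈σT consistent' φ t' with complete φ
    ... | inj₁ t  = t
    ... | inj₂ ¬t = ⊥-elim (consistent' (member-contradiction T' t'
                      (proj₂ (T'≈σT _) (¬' L φ , ¬t , refl))))

  module Invariance {T : Theory L} (lu : LU L T) (σ : SymBij L)
                    (nonEmpty-inv : ∀ R → NonEmpty L T (app σ R) ⇔ NonEmpty L T R) where
    open LU lu
    open CompleteTheory isComplete using (closed)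
    open Complete isComplete

    NonEmptyWhere : (ℕ → Set) → Sym → Set₁
    NonEmptyWhere Q R = NonEmpty L T R × Q (arity R)

    NonEmptyWhere-inv : (Q : ℕ → Set) → ∀ R → NonEmptyWhere Q (app σ R) ⇔ NonEmptyWhere Q R
    NonEmptyWhere-inv Q R =
      mk⇔ (λ { (ne , q) → to (nonEmpty-inv R) ne , subst Q (arity-pres σ R) q })
          (λ { (ne , q) → from (nonEmpty-inv R) ne , subst Q (sym (arity-pres σ R)) q })

    module Where (Q : ℕ → Set) (Q? : ∀ k → Dec (Q k)) =
      Restrict σ (NonEmptyWhere Q) (λ R → nonEmpty? R ×-dec Q? (arity R)) (NonEmptyWhere-inv Q)

    -- σ on the non-empty predicates of arity exactly K: a permutation allowed by LU.
    module At (K : ℕ) = Where (_≡ K) (_≟ K)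

    module Below (K : ℕ) = Where (_< K) (_<? K)

    below-zero : ∀ R → app (Below.restrict 0) R ≡ R
    below-zero R = Below.fwd-off 0 R (λ (_ , R<0) → n≮0 R<0)

    below-suc : ∀ K R → app (At.restrict K) (app (Below.restrict K) R) ≡ app (Below.restrict (suc K)) R
    below-suc K R = byCases (nonEmpty? R) (<-cmp (arity R) K)
      where
      byCases : Dec (NonEmpty L T R) → Tri (arity R < K) (arity R ≡ K) (K < arity R) →
                At.fwd K (Below.fwd K R) ≡ Below.fwd (suc K) R
      byCases (no ¬ne) _ = begin
        At.fwd K (Below.fwd K R)  ≡⟨ cong (At.fwd K) (Below.fwd-off K R (¬ne ∘ proj₁)) ⟩
        At.fwd K R                ≡⟨ At.fwd-off K R (¬ne ∘ proj₁) ⟩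
        R                         ≡⟨ Below.fwd-off (suc K) R (¬ne ∘ proj₁) ⟨
        Below.fwd (suc K) R       ∎
      byCases (yes ne) (tri< R<K _ _) = begin
        At.fwd K (Below.fwd K R)  ≡⟨ cong (At.fwd K) (Below.fwd-on K R (ne , R<K)) ⟩
        At.fwd K (app σ R)        ≡⟨ At.fwd-off K (app σ R) σR≢K ⟩
        app σ R                   ≡⟨ Below.fwd-on (suc K) R (ne , m<n⇒m<1+n R<K) ⟨
        Below.fwd (suc K) R       ∎
        where
        σR≢K : ¬ NonEmptyWhere (_≡ K) (app σ R)
        σR≢K (_ , σR≡K) = <⇒≢ R<K (trans (sym (arity-pres σ R)) σR≡K)
      byCases (yes ne) (tri≈ _ R≡K _) = begin
        At.fwd K (Below.fwd K R)  ≡⟨ cong (At.fwd K) (Below.fwd-off K R (λ (_ , R<K) → <-irrefl R≡K R<K)) ⟩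
        At.fwd K R                ≡⟨ At.fwd-on K R (ne , R≡K) ⟩
        app σ R                   ≡⟨ Below.fwd-on (suc K) R (ne , subst (_< suc K) (sym R≡K) (n<1+n K)) ⟨
        Below.fwd (suc K) R       ∎
      byCases (yes ne) (tri> _ _ K<R) = begin
        At.fwd K (Below.fwd K R)  ≡⟨ cong (At.fwd K) (Below.fwd-off K R (λ (_ , R<K) → <-asym R<K K<R)) ⟩
        At.fwd K R                ≡⟨ At.fwd-off K R (λ (_ , R≡K) → >⇒≢ K<R R≡K) ⟩
        R                         ≡⟨ Below.fwd-off (suc K) R (λ (_ , R<1+K) → <⇒≱ K<R (≤-pred R<1+K)) ⟨
        Below.fwd (suc K) R       ∎

    at-fixes : ∀ K R → (arity R ≢ K ⊎ ¬ NonEmpty L T R) → app (At.restrict K) R ≡ R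
    at-fixes K R fixed = At.fwd-off K R (λ (ne , R≡K) → [ (λ R≢K → R≢K R≡K) , (λ ¬ne → ¬ne ne) ] fixed)

    closed-below : ∀ K ψ → T ψ → T (renSym L (Below.restrict K) ψ)
    closed-below zero    ψ t = subst T (sym (renSym-id (Below.restrict 0) below-zero ψ)) t
    closed-below (suc K) ψ t =
      subst T (renSym-compose (At.restrict K) (Below.restrict K) (Below.restrict (suc K)) (below-suc K) ψ)
        (proj₁ (uniform K (At.restrict K) (at-fixes K) _) (_ , closed-below K ψ t , refl))

    -- In a model of T, σ and below K interpret the symbols of arity < K alike:
    -- on non-empty predicates they coincide, and otherwise both relations are empty.
    below-agrees : (M : Structure L) → _⊨T_ L M T → ∀ K R → arity R < K → ∀ ys →
                   reductRel σ M R ys ⇔ reductRel (Below.restrict K) M R ys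
    below-agrees M M⊨T K R R<K ys = byCases (nonEmpty? R)
      where
      byCases : Dec (NonEmpty L T R) → reductRel σ M R ys ⇔ reductRel (Below.restrict K) M R ys
      byCases (yes ne) = mk⇔ (reductRel-cong σ (Below.restrict K) M R (sym belowR≡σR) ys)
                             (reductRel-cong (Below.restrict K) σ M R belowR≡σR ys)
        where
        belowR≡σR : Below.fwd K R ≡ app σ R
        belowR≡σR = Below.fwd-on K R (ne , R<K)
      byCases (no ¬ne) = mk⇔ (λ h → ⊥-elim (empty-in-model M M⊨T (app σ R) (¬ne ∘ to (nonEmpty-inv R)) _ h))
                             (λ h → ⊥-elim (empty-in-model M M⊨T (Below.fwd K R) ¬ne-belowR _ h))
        where
        ¬ne-belowR : ¬ NonEmpty L T (Below.fwd K R)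
        ¬ne-belowR = subst (λ S → ¬ NonEmpty L T S) (sym (Below.fwd-off K R (¬ne ∘ proj₁))) ¬ne

    -- The invariance principle: with K = symBound ψ, T ⊢ renSym (below K) ψ,
    -- and in models of T this sentence is equivalent to renSym σ ψ.
    invariance : ∀ ψ → T ψ → T (renSym L σ ψ)
    invariance ψ t = closed _ λ M M⊨T →
      from (renSym-agree σ (Below.restrict K) M K (below-agrees M M⊨T K) ψ ≤-refl (λ ()))
           (member⇒⊢ T (closed-below K ψ t) M M⊨T)
      where
      K = symBound ψ

  similar-nonEmpty-inv : {T₁ T₂ : Theory L} → CompleteTheory L T₁ → CompleteTheory L T₂ →
    (σ : SymBij L) → _≈T_ L T₁ (image L σ T₂) → _⊑L_ L T₁ T₂ → _⊑L_ L T₂ T₁ →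
    ∀ R → NonEmpty L T₂ (app σ R) ⇔ NonEmpty L T₂ R
  similar-nonEmpty-inv {T₁} {T₂} C₁ C₂ σ T₁≈σT₂ T₁⊑T₂ T₂⊑T₁ R = mk⇔ reflect preserve
    where
    reflect : NonEmpty L T₂ (app σ R) → NonEmpty L T₂ R
    reflect ne = member⇒⊢ T₂ (Complete.image-reflects C₂ σ T₁ T₁≈σT₂ (CompleteTheory.consistent C₁) _
      (subst T₁ (sym (renSym-nonEmptySent σ R)) (CompleteTheory.closed C₁ _ (T₂⊑T₁ (app σ R) ne))))
    preserve : NonEmpty L T₂ R → NonEmpty L T₂ (app σ R)
    preserve ne = T₁⊑T₂ (app σ R) (member⇒⊢ T₁ (subst T₁ (renSym-nonEmptySent σ R)
      (proj₂ (T₁≈σT₂ _) (_ , CompleteTheory.closed C₂ _ ne , refl))))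

  ⊑L-antisym : {T₁ T₂ : Theory L} → LU L T₁ → LU L T₂ → LanguageSimilar L T₁ T₂ →
               _⊑L_ L T₁ T₂ → _⊑L_ L T₂ T₁ → _≈T_ L T₁ T₂
  ⊑L-antisym {T₁} {T₂} lu₁ lu₂ (σ , T₁≈σT₂) T₁⊑T₂ T₂⊑T₁ φ = T₁⊆T₂ φ , T₂⊆T₁ φ
    where
    C₁ = LU.isComplete lu₁
    C₂ = LU.isComplete lu₂
    T₁⊆T₂ : ∀ φ → T₁ φ → T₂ φ
    T₁⊆T₂ φ t with proj₁ (T₁≈σT₂ φ) t
    ... | ψ , t₂ , σψ≡φ = subst T₂ σψ≡φ (Invariance.invariance lu₂ σ
                            (similar-nonEmpty-inv C₁ C₂ σ T₁≈σT₂ T₁⊑T₂ T₂⊑T₁) ψ t₂)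
    T₂⊆T₁ : ∀ φ → T₂ φ → T₁ φ
    T₂⊆T₁ = Complete.maximal C₁ T₂ (CompleteTheory.consistent C₂) T₁⊆T₂

proposition4p4 : ∀ {ℓ : Level} (L : Language) (S : Theory L → Set ℓ) →
  (∀ T → S T → LU L T) →
  (∀ T₁ T₂ → S T₁ → S T₂ → LanguageSimilar L T₁ T₂) →
  IsPartialOrder {A = Σ (Theory L) S}
    (λ a b → _≈T_ L (proj₁ a) (proj₁ b))
    (λ a b → _⊑L_ L (proj₁ a) (proj₁ b))
proposition4p4 L S isLU similar = record
  { isPreorder = record
    { isEquivalence = record
      { refl  = λ φ → (λ t → t) , (λ t → t)
      ; sym   = λ e φ → proj₂ (e φ) , proj₁ (e φ)
      ; trans = λ e f φ → proj₁ (f φ) ∘ proj₁ (e φ) , proj₂ (e φ) ∘ proj₂ (f φ)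
      }
    ; reflexive = λ e R ne M M⊨T₂ → ne M (λ φ t → M⊨T₂ φ (proj₁ (e φ) t))
    ; trans     = λ f g R → g R ∘ f R
    }
  ; antisym = λ { {T₁ , s₁} {T₂ , s₂} →
      ⊑L-antisym L (isLU T₁ s₁) (isLU T₂ s₂) (similar T₁ T₂ s₁ s₂) }
  }
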